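{- For every integer $m>1$ and every $i\in\{0,1,\ldots,m-1\}$, $r_\mathcal{M}(i,m,2)=m$.
   Context: $\mathbb{N}=\{0,1,2,\ldots\}$. Let $\mathcal{M}=(m^{j-1})_{j\in\mathbb{N}_+}$ and let $p_\mathcal{M}(n,k)$ be the number of tuples $(x_1,\ldots,x_k)\in\mathbb{N}^k$ with $x_1+mx_2+\cdots+m^{k-1}x_k=n$. For integers $k\ge1$ and $i$, define $r_\mathcal{M}(i,m,k)=\#\{n\in\{0,1,\ldots,m^k-1\}:\ p_\mathcal{M}(n,k)\equiv i\pmod{m}\}$. -}

module Defs where

open import Data.Nat using (ℕ; zero; suc; _+_; _*_; _^_; _≟_; NonZero)
open import Data.Nat.DivMod using (_%_)
open import Data.List using (List; []; _∷_; map; concatMap; filter; length; upTo; sum)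
open import Data.Vec using (Vec; []; _∷_)
open import Relation.Binary.PropositionalEquality using (_≡_)

boxTuples : (b k : ℕ) → List (Vec ℕ k)
boxTuples b zero = [] ∷ []
boxTuples b (suc k) =
  concatMap (λ x → map (x ∷_) (boxTuples b k)) (upTo (suc b))

weightedSum' : (m : ℕ) {k : ℕ} → Vec ℕ k → ℕ
weightedSum' m = go 0
  where
  go : {k : ℕ} → ℕ → Vec ℕ k → ℕ
  go j [] = 0
  go j (x ∷ xs) = m ^ j * x + go (suc j) xs

-- p_M(n,k) = #{(x_1,…,x_k) ∈ ℕ^k : x_1 + m x_2 + ⋯ + m^(k-1) x_k = n}.
-- Any solution has every x_j ≤ n (as m^(j-1) ≥ 1 for m ≥ 1), so it suffices
-- to enumerate {0,…,n}^k.
pM : (m n k : ℕ) → ℕ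
pM m n k = length (filter (λ xs → weightedSum' m xs ≟ n) (boxTuples n k))

-- r_M(i,m,k) = #{n ∈ {0,…,m^k - 1} : p_M(n,k) ≡ i (mod m)}, with 0 ≤ i < m
-- (so "≡ i mod m" is "p_M(n,k) % m = i").
rM : (i m k : ℕ) → .⦃ _ : NonZero m ⦄ → ℕ
rM i m k = length (filter (λ n → pM m n k % m ≟ i) (upTo (m ^ k)))

-- Splitting a 2-tuple solution x + m y = n by its second coordinate gives
-- p_M(n,2) = ⌊n/m⌋ + 1: any y ≤ n/m has exactly one partner x.  For n < m²
-- write n = q m + j with q, j < m; then p_M(n,2) ≡ q + 1 (mod m) is
-- independent of j, so each of the m blocks contributes m or 0, and as q
-- runs over 0, …, m-1 the residue q + 1 hits i exactly once.
module Submission where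

open import Defs
open import Data.Nat using (ℕ; _<_; NonZero)
open import Relation.Binary.PropositionalEquality using (_≡_)

open import Data.Bool using (if_then_else_)
open import Data.List using (List; []; _∷_; _++_; map; concatMap; filter; length; applyUpTo; upTo)
open import Data.List.Properties using (map-++; map-∘)
open import Data.Nat using (zero; suc; _+_; _*_; _∸_; _^_; _≤_; s≤s; _≟_; _≤?_)
open import Data.Nat.DivMod using (_/_; _%_; [m+n]%n≡m%n; m*n/n≡m; m/n*n≤m; m/n≤m; /-monoˡ-≤; m<n⇒m/n≡0; +-distrib-/-∣ˡ; m<n⇒m%n≡m)
open import Data.Nat.Divisibility using (n∣m*n)
open import Data.Nat.ListAction using (sum)
open import Data.Nat.ListAction.Properties using (sum-++)
open import Data.Nat.Properties
open import Algebra.Properties.CommutativeSemigroup +-commutativeSemigroup using () renaming (interchange to +-interchange)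
open import Data.Sum using (inj₁; inj₂)
open import Data.Vec using (Vec; []; _∷_)
open import Function using (_∘_; _⇔_; mk⇔)
open import Relation.Binary.PropositionalEquality using (refl; sym; trans; cong; cong₂; module ≡-Reasoning)
open import Relation.Nullary using (Dec; yes; no; ¬_; does)
open import Relation.Nullary.Decidable using (dec-true; dec-false; does-⇔)
open import Relation.Unary using (Pred; Decidable)

open ≡-Reasoning

private
  variable
    A : Set

𝟙 : ∀ {B : Set} → Dec B → ℕ
𝟙 b? = if does b? then 1 else 0

𝟙-yes : ∀ {B : Set} (b? : Dec B) → B → 𝟙 b? ≡ 1
𝟙-yes b? b = cong (λ t → if t then 1 else 0) (dec-true b? b)

𝟙-no : ∀ {B : Set} (b? : Dec B) → ¬ B → 𝟙 b? ≡ 0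
𝟙-no b? ¬b = cong (λ t → if t then 1 else 0) (dec-false b? ¬b)

𝟙-⇔ : ∀ {B C : Set} → B ⇔ C → (b? : Dec B) (c? : Dec C) → 𝟙 b? ≡ 𝟙 c?
𝟙-⇔ B⇔C b? c? = cong (λ t → if t then 1 else 0) (does-⇔ B⇔C b? c?)

∑< : ℕ → (ℕ → ℕ) → ℕ
∑< zero    f = 0
∑< (suc n) f = ∑< n f + f n

syntax ∑< n (λ i → e) = ∑[ i < n ] e

∑-cong< : ∀ n {f g : ℕ → ℕ} → (∀ i → i < n → f i ≡ g i) → ∑< n f ≡ ∑< n g
∑-cong< zero    f≡g = refl
∑-cong< (suc n) f≡g = cong₂ _+_ (∑-cong< n (λ i i<n → f≡g i (m<n⇒m<1+n i<n))) (f≡g n ≤-refl)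

∑-cong : ∀ n {f g : ℕ → ℕ} → (∀ i → f i ≡ g i) → ∑< n f ≡ ∑< n g
∑-cong n f≡g = ∑-cong< n (λ i _ → f≡g i)

∑-const : ∀ n c → ∑[ i < n ] c ≡ n * c
∑-const zero    c = refl
∑-const (suc n) c = trans (cong (_+ c) (∑-const n c)) (+-comm (n * c) c)

∑-distrib-+ : ∀ n f g → ∑[ i < n ] (f i + g i) ≡ ∑< n f + ∑< n g
∑-distrib-+ zero    f g = refl
∑-distrib-+ (suc n) f g =
  trans (cong (_+ (f n + g n)) (∑-distrib-+ n f g)) (+-interchange (∑< n f) (∑< n g) (f n) (g n))

∑-comm : ∀ a b (f : ℕ → ℕ → ℕ) → ∑[ x < a ] ∑[ y < b ] f x y ≡ ∑[ y < b ] ∑[ x < a ] f x y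
∑-comm zero    b f = sym (trans (∑-const b 0) (*-zeroʳ b))
∑-comm (suc a) b f = begin
  ∑[ x < a ] ∑[ y < b ] f x y + ∑[ y < b ] f a y ≡⟨ cong (_+ ∑[ y < b ] f a y) (∑-comm a b f) ⟩
  ∑[ y < b ] ∑[ x < a ] f x y + ∑[ y < b ] f a y ≡⟨ ∑-distrib-+ b (λ y → ∑[ x < a ] f x y) (f a) ⟨
  ∑[ y < b ] ∑[ x < suc a ] f x y               ∎

∑-unshift : ∀ n f → ∑< (suc n) f ≡ f 0 + ∑[ i < n ] f (suc i)
∑-unshift zero    f = +-comm 0 (f 0)
∑-unshift (suc n) f = begin
  ∑< (suc n) f + f (suc n)                  ≡⟨ cong (_+ f (suc n)) (∑-unshift n f) ⟩
  f 0 + ∑[ i < n ] f (suc i) + f (suc n)    ≡⟨ +-assoc (f 0) _ _ ⟩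
  f 0 + ∑[ i < suc n ] f (suc i)            ∎

∑-rotate : ∀ n f → f n ≡ f 0 → ∑[ i < n ] f (suc i) ≡ ∑< n f
∑-rotate n f fn≡f0 = +-cancelˡ-≡ (f 0) _ _ (begin
  f 0 + ∑[ i < n ] f (suc i) ≡⟨ ∑-unshift n f ⟨
  ∑< n f + f n               ≡⟨ cong (∑< n f +_) fn≡f0 ⟩
  ∑< n f + f 0               ≡⟨ +-comm (∑< n f) (f 0) ⟩
  f 0 + ∑< n f               ∎)

∑-split : ∀ k l f → ∑< (k + l) f ≡ ∑< k f + ∑[ j < l ] f (k + j)
∑-split k zero    f = trans (cong (λ n → ∑< n f) (+-identityʳ k)) (sym (+-identityʳ _))
∑-split k (suc l) f = begin
  ∑< (k + suc l) f                               ≡⟨ cong (λ n → ∑< n f) (+-suc k l) ⟩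
  ∑< (k + l) f + f (k + l)                       ≡⟨ cong (_+ f (k + l)) (∑-split k l f) ⟩
  ∑< k f + ∑[ j < l ] f (k + j) + f (k + l)      ≡⟨ +-assoc (∑< k f) _ _ ⟩
  ∑< k f + ∑[ j < suc l ] f (k + j)              ∎

∑-𝟙-none : ∀ n {P : Pred ℕ _} (P? : Decidable P) → (∀ i → i < n → ¬ P i) → ∑[ i < n ] 𝟙 (P? i) ≡ 0
∑-𝟙-none n P? ¬P = begin
  ∑[ i < n ] 𝟙 (P? i) ≡⟨ ∑-cong< n (λ i i<n → 𝟙-no (P? i) (¬P i i<n)) ⟩
  ∑[ i < n ] 0        ≡⟨ ∑-const n 0 ⟩
  n * 0               ≡⟨ *-zeroʳ n ⟩
  0                   ∎

∑-𝟙-all : ∀ n {P : Pred ℕ _} (P? : Decidable P) → (∀ i → i < n → P i) → ∑[ i < n ] 𝟙 (P? i) ≡ n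
∑-𝟙-all n P? P = begin
  ∑[ i < n ] 𝟙 (P? i) ≡⟨ ∑-cong< n (λ i i<n → 𝟙-yes (P? i) (P i i<n)) ⟩
  ∑[ i < n ] 1        ≡⟨ ∑-const n 1 ⟩
  n * 1               ≡⟨ *-identityʳ n ⟩
  n                   ∎

∑-𝟙-≟ : ∀ {n c} → c < n → ∑[ i < n ] 𝟙 (i ≟ c) ≡ 1
∑-𝟙-≟ {suc n} (s≤s c≤n) with m≤n⇒m<n∨m≡n c≤n
... | inj₁ c<n  = cong₂ _+_ (∑-𝟙-≟ c<n) (𝟙-no (n ≟ _) (λ n≡c → <-irrefl (sym n≡c) c<n))
... | inj₂ refl = cong₂ _+_ (∑-𝟙-none n (_≟ n) (λ i i<n i≡n → <-irrefl i≡n i<n)) (𝟙-yes (n ≟ n) refl)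

∑-𝟙-≤ : ∀ {n c} → c < n → ∑[ i < n ] 𝟙 (i ≤? c) ≡ suc c
∑-𝟙-≤ {n} {c} c<n = begin
  ∑[ i < n ] 𝟙 (i ≤? c)                                   ≡⟨ cong (λ k → ∑[ i < k ] 𝟙 (i ≤? c)) (m+[n∸m]≡n c<n) ⟨
  ∑[ i < suc c + (n ∸ suc c) ] 𝟙 (i ≤? c)                 ≡⟨ ∑-split (suc c) (n ∸ suc c) _ ⟩
  ∑[ i < suc c ] 𝟙 (i ≤? c) + ∑[ j < n ∸ suc c ] 𝟙 (suc c + j ≤? c)
    ≡⟨ cong₂ _+_ (∑-𝟙-all (suc c) (_≤? c) (λ i → ≤-pred))
                 (∑-𝟙-none (n ∸ suc c) (λ j → suc c + j ≤? c) (λ j _ → <⇒≱ (m≤m+n (suc c) j))) ⟩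
  suc c + 0                                               ≡⟨ +-identityʳ (suc c) ⟩
  suc c                                                   ∎

∑-𝟙-+≟ : ∀ n c → ∑[ x < suc n ] 𝟙 (x + c ≟ n) ≡ 𝟙 (c ≤? n)
∑-𝟙-+≟ n c with c ≤? n
... | yes c≤n = begin
  ∑[ x < suc n ] 𝟙 (x + c ≟ n) ≡⟨ ∑-cong (suc n) (λ x → 𝟙-⇔ (x+c≡n⇔x≡n∸c x) (x + c ≟ n) (x ≟ n ∸ c)) ⟩
  ∑[ x < suc n ] 𝟙 (x ≟ n ∸ c) ≡⟨ ∑-𝟙-≟ (s≤s (m∸n≤m n c)) ⟩
  1                            ≡⟨ 𝟙-yes (c ≤? n) c≤n ⟨
  𝟙 (c ≤? n)                   ∎
  where
  x+c≡n⇔x≡n∸c : ∀ x → x + c ≡ n ⇔ x ≡ n ∸ c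
  x+c≡n⇔x≡n∸c x = mk⇔ (λ x+c≡n → trans (sym (m+n∸n≡m x c)) (cong (_∸ c) x+c≡n))
                      (λ x≡n∸c → trans (cong (_+ c) x≡n∸c) (m∸n+n≡m c≤n))
... | no c≰n = begin
  ∑[ x < suc n ] 𝟙 (x + c ≟ n) ≡⟨ ∑-𝟙-none (suc n) (λ x → x + c ≟ n) (λ x _ x+c≡n → c≰n (≤-trans (m≤n+m c x) (≤-reflexive x+c≡n))) ⟩
  0                            ≡⟨ 𝟙-no (c ≤? n) c≰n ⟨
  𝟙 (c ≤? n)                   ∎

length-filter : ∀ {P : Pred A _} (P? : Decidable P) xs → length (filter P? xs) ≡ sum (map (𝟙 ∘ P?) xs)
length-filter P? []       = refl
length-filter P? (x ∷ xs) with P? x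
... | yes _ = cong suc (length-filter P? xs)
... | no  _ = length-filter P? xs

sum-map-concatMap : ∀ {B : Set} (f : B → ℕ) (g : A → List B) xs →
                    sum (map f (concatMap g xs)) ≡ sum (map (λ x → sum (map f (g x))) xs)
sum-map-concatMap f g []       = refl
sum-map-concatMap f g (x ∷ xs) = begin
  sum (map f (g x ++ concatMap g xs))             ≡⟨ cong sum (map-++ f (g x) (concatMap g xs)) ⟩
  sum (map f (g x) ++ map f (concatMap g xs))     ≡⟨ sum-++ (map f (g x)) _ ⟩
  sum (map f (g x)) + sum (map f (concatMap g xs)) ≡⟨ cong (sum (map f (g x)) +_) (sum-map-concatMap f g xs) ⟩
  sum (map f (g x)) + sum (map (λ x → sum (map f (g x))) xs) ∎

sum-map-applyUpTo : ∀ n (f g : ℕ → ℕ) → sum (map f (applyUpTo g n)) ≡ ∑[ i < n ] f (g i)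
sum-map-applyUpTo zero    f g = refl
sum-map-applyUpTo (suc n) f g =
  trans (cong (f (g 0) +_) (sum-map-applyUpTo n f (g ∘ suc))) (sym (∑-unshift n (f ∘ g)))

sum-map-upTo : ∀ n (f : ℕ → ℕ) → sum (map f (upTo n)) ≡ ∑< n f
sum-map-upTo n f = sum-map-applyUpTo n f (λ i → i)

length-filter-upTo : ∀ {P : Pred ℕ _} (P? : Decidable P) n → length (filter P? (upTo n)) ≡ ∑[ i < n ] 𝟙 (P? i)
length-filter-upTo P? n = trans (length-filter P? (upTo n)) (sum-map-upTo n (𝟙 ∘ P?))

length-filter-boxTuples₂ : ∀ {P : Pred (Vec ℕ 2) _} (P? : Decidable P) b →
  length (filter P? (boxTuples b 2)) ≡ ∑[ x < suc b ] ∑[ y < suc b ] 𝟙 (P? (x ∷ y ∷ []))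
length-filter-boxTuples₂ P? b = begin
  length (filter P? (boxTuples b 2))
    ≡⟨ length-filter P? (boxTuples b 2) ⟩
  sum (map (𝟙 ∘ P?) (concatMap (λ x → map (x ∷_) (boxTuples b 1)) (upTo (suc b))))
    ≡⟨ sum-map-concatMap (𝟙 ∘ P?) (λ x → map (x ∷_) (boxTuples b 1)) (upTo (suc b)) ⟩
  sum (map (λ x → sum (map (𝟙 ∘ P?) (map (x ∷_) (boxTuples b 1)))) (upTo (suc b)))
    ≡⟨ sum-map-upTo (suc b) _ ⟩
  ∑[ x < suc b ] sum (map (𝟙 ∘ P?) (map (x ∷_) (boxTuples b 1)))
    ≡⟨ ∑-cong (suc b) row ⟩
  ∑[ x < suc b ] ∑[ y < suc b ] 𝟙 (P? (x ∷ y ∷ [])) ∎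
  where
  row : ∀ x → sum (map (𝟙 ∘ P?) (map (x ∷_) (boxTuples b 1))) ≡ ∑[ y < suc b ] 𝟙 (P? (x ∷ y ∷ []))
  row x = begin
    sum (map (𝟙 ∘ P?) (map (x ∷_) (boxTuples b 1)))   ≡⟨ cong sum (map-∘ (boxTuples b 1)) ⟨
    sum (map (𝟙 ∘ P? ∘ (x ∷_)) (boxTuples b 1))       ≡⟨ sum-map-concatMap (𝟙 ∘ P? ∘ (x ∷_)) (λ y → (y ∷ []) ∷ []) (upTo (suc b)) ⟩
    sum (map (λ y → 𝟙 (P? (x ∷ y ∷ [])) + 0) (upTo (suc b))) ≡⟨ sum-map-upTo (suc b) _ ⟩
    ∑[ y < suc b ] (𝟙 (P? (x ∷ y ∷ [])) + 0)          ≡⟨ ∑-cong (suc b) (λ y → +-identityʳ _) ⟩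
    ∑[ y < suc b ] 𝟙 (P? (x ∷ y ∷ []))                ∎

m*n≤o⇔n≤o/m : ∀ m {n o} .{{_ : NonZero m}} → m * n ≤ o ⇔ n ≤ o / m
m*n≤o⇔n≤o/m m {n} {o} = mk⇔ to from
  where
  to : m * n ≤ o → n ≤ o / m
  to mn≤o = ≤-trans (≤-reflexive (trans (sym (m*n/n≡m n m)) (cong (_/ m) (*-comm n m)))) (/-monoˡ-≤ m mn≤o)

  from : n ≤ o / m → m * n ≤ o
  from n≤o/m = ≤-trans (*-monoʳ-≤ m n≤o/m) (≤-trans (≤-reflexive (*-comm m (o / m))) (m/n*n≤m o m))

[q*m+j]/m≡q : ∀ q m j .{{_ : NonZero m}} → j < m → (q * m + j) / m ≡ q
[q*m+j]/m≡q q m j j<m = begin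
  (q * m + j) / m       ≡⟨ +-distrib-/-∣ˡ j (n∣m*n q) ⟩
  q * m / m + j / m     ≡⟨ cong₂ _+_ (m*n/n≡m q m) (m<n⇒m/n≡0 j<m) ⟩
  q + 0                 ≡⟨ +-identityʳ q ⟩
  q                     ∎

∑-/-blocks : ∀ a m .{{_ : NonZero m}} (f : ℕ → ℕ) → ∑[ n < a * m ] f (n / m) ≡ m * ∑< a f
∑-/-blocks zero    m f = sym (*-zeroʳ m)
∑-/-blocks (suc a) m f = begin
  ∑[ n < m + a * m ] f (n / m)
    ≡⟨ cong (λ k → ∑[ n < k ] f (n / m)) (+-comm m (a * m)) ⟩
  ∑[ n < a * m + m ] f (n / m)
    ≡⟨ ∑-split (a * m) m _ ⟩
  ∑[ n < a * m ] f (n / m) + ∑[ j < m ] f ((a * m + j) / m)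
    ≡⟨ cong₂ _+_ (∑-/-blocks a m f) (∑-cong< m (λ j j<m → cong f ([q*m+j]/m≡q a m j j<m))) ⟩
  m * ∑< a f + ∑[ j < m ] f a
    ≡⟨ cong (m * ∑< a f +_) (∑-const m (f a)) ⟩
  m * ∑< a f + m * f a
    ≡⟨ *-distribˡ-+ m (∑< a f) (f a) ⟨
  m * ∑< (suc a) f ∎

∑-𝟙-suc%≟ : ∀ {m i} .{{_ : NonZero m}} → i < m → ∑[ q < m ] 𝟙 (suc q % m ≟ i) ≡ 1
∑-𝟙-suc%≟ {m} {i} i<m = begin
  ∑[ q < m ] 𝟙 (suc q % m ≟ i) ≡⟨ ∑-rotate m (λ q → 𝟙 (q % m ≟ i)) (cong (λ r → 𝟙 (r ≟ i)) ([m+n]%n≡m%n 0 m)) ⟩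
  ∑[ q < m ] 𝟙 (q % m ≟ i)     ≡⟨ ∑-cong< m (λ q q<m → cong (λ r → 𝟙 (r ≟ i)) (m<n⇒m%n≡m q<m)) ⟩
  ∑[ q < m ] 𝟙 (q ≟ i)         ≡⟨ ∑-𝟙-≟ i<m ⟩
  1                            ∎

weightedSum'-two : ∀ m x y → weightedSum' m (x ∷ y ∷ []) ≡ x + m * y
weightedSum'-two m x y = cong₂ _+_ (*-identityˡ x) (trans (+-identityʳ _) (cong (_* y) (*-identityʳ m)))

pM-two : ∀ m n .{{_ : NonZero m}} → pM m n 2 ≡ suc (n / m)
pM-two m n = begin
  pM m n 2
    ≡⟨ length-filter-boxTuples₂ (λ xs → weightedSum' m xs ≟ n) n ⟩
  ∑[ x < suc n ] ∑[ y < suc n ] 𝟙 (weightedSum' m (x ∷ y ∷ []) ≟ n)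
    ≡⟨ ∑-comm (suc n) (suc n) _ ⟩
  ∑[ y < suc n ] ∑[ x < suc n ] 𝟙 (weightedSum' m (x ∷ y ∷ []) ≟ n)
    ≡⟨ ∑-cong (suc n) (λ y → ∑-cong (suc n) (λ x → cong (λ k → 𝟙 (k ≟ n)) (weightedSum'-two m x y))) ⟩
  ∑[ y < suc n ] ∑[ x < suc n ] 𝟙 (x + m * y ≟ n)
    ≡⟨ ∑-cong (suc n) (λ y → ∑-𝟙-+≟ n (m * y)) ⟩
  ∑[ y < suc n ] 𝟙 (m * y ≤? n)
    ≡⟨ ∑-cong (suc n) (λ y → 𝟙-⇔ (m*n≤o⇔n≤o/m m) (m * y ≤? n) (y ≤? n / m)) ⟩
  ∑[ y < suc n ] 𝟙 (y ≤? n / m)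
    ≡⟨ ∑-𝟙-≤ (s≤s (m/n≤m n m)) ⟩
  suc (n / m) ∎

corollary6p11 : ∀ (m i : ℕ) → 1 < m → .⦃ _ : NonZero m ⦄ → i < m → rM i m 2 ≡ m
corollary6p11 m i _ i<m = begin
  rM i m 2                                        ≡⟨ length-filter-upTo (λ n → pM m n 2 % m ≟ i) (m ^ 2) ⟩
  ∑[ n < m ^ 2 ] 𝟙 (pM m n 2 % m ≟ i)            ≡⟨ cong (λ k → ∑[ n < m * k ] 𝟙 (pM m n 2 % m ≟ i)) (*-identityʳ m) ⟩
  ∑[ n < m * m ] 𝟙 (pM m n 2 % m ≟ i)            ≡⟨ ∑-cong (m * m) (λ n → cong (λ k → 𝟙 (k % m ≟ i)) (pM-two m n)) ⟩
  ∑[ n < m * m ] 𝟙 (suc (n / m) % m ≟ i)         ≡⟨ ∑-/-blocks m m (λ q → 𝟙 (suc q % m ≟ i)) ⟩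
  m * ∑[ q < m ] 𝟙 (suc q % m ≟ i)               ≡⟨ cong (m *_) (∑-𝟙-suc%≟ i<m) ⟩
  m * 1                                           ≡⟨ *-identityʳ m ⟩
  m                                               ∎
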